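{- Let $\mathcal{M}=(S,\sqsubseteq,P,\{R_i\}_{i\in I},\pi)$ be a relational possibility model and $\varphi$ a formula of $\mathcal{L}(I)$. Let $S_\varphi=\{x\in S\mid$ for every subformula $\psi$ of $\varphi$, $\mathcal{M},x\Vdash\psi$ or $\mathcal{M},x\Vdash\neg\psi\}$, and let $\mathcal{M}_\varphi$ be the Kripke model with set of worlds $S_\varphi$, relations $R_{i,\varphi}$ on $S_\varphi$ given by $xR_{i,\varphi}y$ iff there is $z\in S$ with $xR_iz$ and $y\sqsubseteq z$, and valuation $\pi_\varphi(p)=\pi(p)\cap S_\varphi$. Then: \begin{enumerate} \item for every $x\in S$ there is $x'\in S_\varphi$ with $x'\sqsubseteq x$; \item for every $x\in S_\varphi$ and every subformula $\psi$ of $\varphi$, $\mathcal{M},x\Vdash\psi$ iff $\mathcal{M}_\varphi,x\Vdash\psi$. \end{enumerate}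
   Context: $\mathcal{L}(I)$: $\varphi::=p\mid\neg\varphi\mid(\varphi\wedge\varphi)\mid\Box_i\varphi$ ($i\in I$). For a poset $(S,\sqsubseteq)$, $\mathcal{RO}(S,\sqsubseteq)$ is the set of $U=\{x\mid\forall x'\sqsubseteq x\ \exists x''\sqsubseteq x':x''\in U\}$, with $\neg U=\{x\mid\forall x'\sqsubseteq x\ x'\notin U\}$. A relational possibility frame is $(S,\sqsubseteq,P,\{R_i\}_{i\in I})$ with $(S,\sqsubseteq)$ a poset, $\varnothing\ne P\subseteq\mathcal{RO}(S,\sqsubseteq)$ closed under $\neg$, $\cap$, and each $\Box_i Z=\{x\mid R_i(x)\subseteq Z\}$ (where $R_i(x)=\{y\mid xR_iy\}$, $R_i$ a binary relation on $S$). A model adds $\pi$ from propositional variables to $P$; $x\Vdash p$ iff $x\in\pi(p)$; $x\Vdash\neg\psi$ iff no $x'\sqsubseteq x$ has $x'\Vdash\psi$; $\wedge$ pointwise; $x\Vdash\Box_i\psi$ iff $y\Vdash\psi$ for all $y$ with $xR_iy$. In a Kripke model (set of worlds, relations, valuation into subsets), truth is standard: $\neg$ is complement, $\wedge$ pointwise, $\Box_i$ by all $R_i$-successors. -}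

module Defs where

open import Level using (0ℓ)
open import Data.Product using (Σ; Σ-syntax; ∃; _×_; _,_; proj₁)
open import Data.Sum using (_⊎_)
open import Relation.Nullary using (¬_)
open import Relation.Binary.PropositionalEquality using (_≡_)
open import Relation.Binary.Structures using (IsPartialOrder)

Pred : Set → Set₁
Pred S = S → Set

data Form (I : Set) (Var : Set) : Set where
  var : Var → Form I Var
  neg : Form I Var → Form I Var
  and : Form I Var → Form I Var → Form I Var
  box : I → Form I Var → Form I Var

data Sub {I Var : Set} : Form I Var → Form I Var → Set where
  here : ∀ {φ} → Sub φ φ
  inNeg : ∀ {ψ φ} → Sub ψ φ → Sub ψ (neg φ)
  inAndL : ∀ {ψ φ χ} → Sub ψ φ → Sub ψ (and φ χ)
  inAndR : ∀ {ψ φ χ} → Sub ψ χ → Sub ψ (and φ χ)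
  inBox : ∀ {ψ φ} {i : I} → Sub ψ φ → Sub ψ (box i φ)

module _ {S : Set} (_⊑_ : S → S → Set) where
  IsRO : Pred S → Set
  IsRO U = ∀ x → (U x → ∀ x' → x' ⊑ x → Σ[ x'' ∈ S ] (x'' ⊑ x' × U x''))
               × ((∀ x' → x' ⊑ x → Σ[ x'' ∈ S ] (x'' ⊑ x' × U x'')) → U x)

  negRO : Pred S → Pred S
  negRO U x = ∀ x' → x' ⊑ x → ¬ U x'

interPred : {S : Set} → Pred S → Pred S → Pred S
interPred U V x = U x × V x

boxPred : {S : Set} → (S → S → Set) → Pred S → Pred S
boxPred R Z x = ∀ y → R x y → Z y

record PossFrame (I : Set) : Set₂ where
  field
    S : Set
    _⊑_ : S → S → Set
    isPO : IsPartialOrder _≡_ _⊑_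
    P : Pred S → Set₁
    P-RO : ∀ U → P U → IsRO _⊑_ U
    P-nonempty : Σ[ U ∈ Pred S ] P U
    P-neg : ∀ U → P U → P (negRO _⊑_ U)
    P-inter : ∀ U V → P U → P V → P (interPred U V)
    R : I → S → S → Set
    P-box : ∀ i U → P U → P (boxPred (R i) U)

record PossModel (I Var : Set) : Set₂ where
  field
    frame : PossFrame I
  open PossFrame frame public
  field
    π : Var → Pred S
    π-P : ∀ p → P (π p)

module _ {I Var : Set} (M : PossModel I Var) where
  open PossModel M
  _⊩_ : S → Form I Var → Set
  x ⊩ var p = π p x
  x ⊩ neg ψ = ∀ x' → x' ⊑ x → ¬ (x' ⊩ ψ)
  x ⊩ and ψ χ = (x ⊩ ψ) × (x ⊩ χ)
  x ⊩ box i ψ = ∀ y → R i x y → y ⊩ ψ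

record KripkeModel (I Var : Set) : Set₁ where
  field
    W : Set
    Rel : I → W → W → Set
    V : Var → Pred W

module _ {I Var : Set} (K : KripkeModel I Var) where
  open KripkeModel K
  _⊨_ : W → Form I Var → Set
  w ⊨ var p = V p w
  w ⊨ neg ψ = ¬ (w ⊨ ψ)
  w ⊨ and ψ χ = (w ⊨ ψ) × (w ⊨ χ)
  w ⊨ box i ψ = ∀ v → Rel i w v → v ⊨ ψ

module _ {I Var : Set} (M : PossModel I Var) (φ : Form I Var) where
  open PossModel M

  Sφ : Pred S
  Sφ x = ∀ ψ → Sub ψ φ → (_⊩_ M x ψ) ⊎ (_⊩_ M x (neg ψ))

  Mφ : KripkeModel I Var
  Mφ = record
    { W = Σ S Sφ
    ; Rel = λ i x y → Σ[ z ∈ S ] (R i (proj₁ x) z × (proj₁ y ⊑ z))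
    ; V = λ p x → π p (proj₁ x)   -- π_φ(p) = π(p) ∩ S_φ
    }

-- Every truth set of M lies in P, hence is regular open and downward closed. With excluded
-- middle every point can be refined until it decides a given formula; since deciding is
-- downward closed, refining once per subformula of φ shows that S_φ is dense. In M_φ a
-- world sees exactly the refinements of R_i-successors that lie in S_φ, and regularity plus
-- density of S_φ lets the truth of □_i ψ be read off those refinements alone.
module Submission where

open import Defs
open import Level using (0ℓ)
open import Data.Product using (Σ; Σ-syntax; _×_; _,_; proj₁; proj₂)
open import Data.Sum using (_⊎_; inj₁; inj₂)
open import Data.Empty using (⊥-elim)
open import Function.Bundles using (_⇔_; mk⇔; Equivalence)
open import Axiom.ExcludedMiddle using (ExcludedMiddle)
open import Relation.Nullary using (¬_; yes; no)
open import Relation.Binary.Definitions using (Transitive)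
open import Relation.Binary.Structures using (IsPartialOrder)

Sub-trans : {I Var : Set} {ψ χ φ : Form I Var} → Sub ψ χ → Sub χ φ → Sub ψ φ
Sub-trans s here       = s
Sub-trans s (inNeg t)  = inNeg (Sub-trans s t)
Sub-trans s (inAndL t) = inAndL (Sub-trans s t)
Sub-trans s (inAndR t) = inAndR (Sub-trans s t)
Sub-trans s (inBox t)  = inBox (Sub-trans s t)

module _ {S : Set} (_⊑_ : S → S → Set) where

  Persistent : Pred S → Set
  Persistent U = ∀ {x y} → U x → y ⊑ x → U y

  Dense : Pred S → Set
  Dense U = ∀ x → Σ[ x' ∈ S ] (U x' × x' ⊑ x)

  Dense-mono : ∀ {U V} → (∀ {x} → U x → V x) → Dense U → Dense V
  Dense-mono U⊆V dense x = let (x' , Ux' , x'⊑x) = dense x in x' , U⊆V Ux' , x'⊑x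

module _ {S : Set} {_⊑_ : S → S → Set} (⊑-trans : Transitive _⊑_) where

  IsRO⇒Persistent : ∀ {U} → IsRO _⊑_ U → Persistent _⊑_ U
  IsRO⇒Persistent ro {x} {y} Ux y⊑x =
    proj₂ (ro y) (λ y' y'⊑y → proj₁ (ro x) Ux y' (⊑-trans y'⊑y y⊑x))

  IsRO-from-dense : ∀ {U D} → IsRO _⊑_ U → Dense _⊑_ D →
                           ∀ x → (∀ y → D y → y ⊑ x → U y) → U x
  IsRO-from-dense ro dense x U-on-D = proj₂ (ro x) λ x' x'⊑x →
    let (x'' , Dx'' , x''⊑x') = dense x'
    in x'' , x''⊑x' , U-on-D x'' Dx'' (⊑-trans x''⊑x' x'⊑x)

  Dense-∩ : ∀ {U V} → Persistent _⊑_ U → Dense _⊑_ U → Dense _⊑_ V →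
            Dense _⊑_ (interPred U V)
  Dense-∩ persU denseU denseV x =
    let (x₁ , Ux₁ , x₁⊑x)  = denseU x
        (x₂ , Vx₂ , x₂⊑x₁) = denseV x₁
    in x₂ , (persU Ux₁ x₂⊑x₁ , Vx₂) , ⊑-trans x₂⊑x₁ x₁⊑x

module _ {I Var : Set} (M : PossModel I Var) where
  open PossModel M
  open IsPartialOrder isPO using () renaming (refl to ⊑-refl; trans to ⊑-trans)

  ⊩-∈P : ∀ ψ → P (λ x → _⊩_ M x ψ)
  ⊩-∈P (var p)   = π-P p
  ⊩-∈P (neg ψ)   = P-neg _ (⊩-∈P ψ)
  ⊩-∈P (and ψ χ) = P-inter _ _ (⊩-∈P ψ) (⊩-∈P χ)
  ⊩-∈P (box i ψ) = P-box i _ (⊩-∈P ψ)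

  ⊩-IsRO : ∀ ψ → IsRO _⊑_ (λ x → _⊩_ M x ψ)
  ⊩-IsRO ψ = P-RO _ (⊩-∈P ψ)

  ⊩-persistent : ∀ ψ → Persistent _⊑_ (λ x → _⊩_ M x ψ)
  ⊩-persistent ψ = IsRO⇒Persistent ⊑-trans (⊩-IsRO ψ)

  Decides : Form I Var → Pred S
  Decides ψ x = _⊩_ M x ψ ⊎ _⊩_ M x (neg ψ)

  Decides-persistent : ∀ ψ → Persistent _⊑_ (Decides ψ)
  Decides-persistent ψ (inj₁ x⊩ψ)  y⊑x = inj₁ (⊩-persistent ψ x⊩ψ y⊑x)
  Decides-persistent ψ (inj₂ x⊩¬ψ) y⊑x = inj₂ (⊩-persistent (neg ψ) x⊩¬ψ y⊑x)

  Decides-dense : ExcludedMiddle 0ℓ → ∀ ψ → Dense _⊑_ (Decides ψ)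
  Decides-dense lem ψ x with lem {Σ[ x' ∈ S ] (x' ⊑ x × _⊩_ M x' ψ)}
  ... | yes (x' , x'⊑x , x'⊩ψ) = x' , inj₁ x'⊩ψ , x'⊑x
  ... | no ∄x' = x , inj₂ (λ x' x'⊑x x'⊩ψ → ∄x' (x' , x'⊑x , x'⊩ψ)) , ⊑-refl

  Sφ-persistent : ∀ φ → Persistent _⊑_ (Sφ M φ)
  Sφ-persistent φ Sφx y⊑x ψ ψ≤φ = Decides-persistent ψ (Sφx ψ ψ≤φ) y⊑x

  Sφ-var : ∀ {p x} → Decides (var p) x → Sφ M (var p) x
  Sφ-var d _ here = d

  Sφ-neg : ∀ {ψ x} → interPred (Decides (neg ψ)) (Sφ M ψ) x → Sφ M (neg ψ) x
  Sφ-neg (d , _)   _ here      = d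
  Sφ-neg (_ , Sψ)  θ (inNeg s) = Sψ θ s

  Sφ-and : ∀ {ψ χ x} → interPred (Decides (and ψ χ)) (interPred (Sφ M ψ) (Sφ M χ)) x →
           Sφ M (and ψ χ) x
  Sφ-and (d , _)        _ here       = d
  Sφ-and (_ , Sψ , _)   θ (inAndL s) = Sψ θ s
  Sφ-and (_ , _ , Sχ)   θ (inAndR s) = Sχ θ s

  Sφ-box : ∀ {i ψ x} → interPred (Decides (box i ψ)) (Sφ M ψ) x → Sφ M (box i ψ) x
  Sφ-box (d , _)  _ here      = d
  Sφ-box (_ , Sψ) θ (inBox s) = Sψ θ s

  Sφ-dense : ExcludedMiddle 0ℓ → ∀ φ → Dense _⊑_ (Sφ M φ)
  Sφ-dense lem (var p)   = Dense-mono _⊑_ Sφ-var (Decides-dense lem (var p))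
  Sφ-dense lem (neg ψ)   = Dense-mono _⊑_ Sφ-neg
    (Dense-∩ ⊑-trans (Decides-persistent (neg ψ)) (Decides-dense lem (neg ψ)) (Sφ-dense lem ψ))
  Sφ-dense lem (and ψ χ) = Dense-mono _⊑_ Sφ-and
    (Dense-∩ ⊑-trans (Decides-persistent (and ψ χ)) (Decides-dense lem (and ψ χ))
      (Dense-∩ ⊑-trans (Sφ-persistent ψ) (Sφ-dense lem ψ) (Sφ-dense lem χ)))
  Sφ-dense lem (box i ψ) = Dense-mono _⊑_ Sφ-box
    (Dense-∩ ⊑-trans (Decides-persistent (box i ψ)) (Decides-dense lem (box i ψ)) (Sφ-dense lem ψ))

  module _ (φ : Form I Var) (Sφ-isDense : Dense _⊑_ (Sφ M φ)) where

    ⊩⇔⊨Mφ : ∀ ψ → Sub ψ φ → ∀ x (sx : Sφ M φ x) → _⊩_ M x ψ ⇔ _⊨_ (Mφ M φ) (x , sx) ψ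
    ⊩⇔⊨Mφ (var p) _ x sx = mk⇔ (λ h → h) (λ h → h)
    ⊩⇔⊨Mφ (neg ψ) ¬ψ≤φ x sx = mk⇔
      (λ x⊩¬ψ x⊨ψ → x⊩¬ψ x ⊑-refl (Equivalence.from ih x⊨ψ))
      (λ x⊭ψ → from-decided x⊭ψ (sx ψ ψ≤φ))
      where
        ψ≤φ = Sub-trans (inNeg here) ¬ψ≤φ
        ih  = ⊩⇔⊨Mφ ψ ψ≤φ x sx
        from-decided : ¬ (_⊨_ (Mφ M φ) (x , sx) ψ) → Decides ψ x → _⊩_ M x (neg ψ)
        from-decided x⊭ψ (inj₁ x⊩ψ)  = ⊥-elim (x⊭ψ (Equivalence.to ih x⊩ψ))
        from-decided x⊭ψ (inj₂ x⊩¬ψ) = x⊩¬ψ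
    ⊩⇔⊨Mφ (and ψ χ) ψχ≤φ x sx = mk⇔
      (λ (x⊩ψ , x⊩χ) → Equivalence.to ihψ x⊩ψ , Equivalence.to ihχ x⊩χ)
      (λ (x⊨ψ , x⊨χ) → Equivalence.from ihψ x⊨ψ , Equivalence.from ihχ x⊨χ)
      where
        ihψ = ⊩⇔⊨Mφ ψ (Sub-trans (inAndL here) ψχ≤φ) x sx
        ihχ = ⊩⇔⊨Mφ χ (Sub-trans (inAndR here) ψχ≤φ) x sx
    ⊩⇔⊨Mφ (box i ψ) □ψ≤φ x sx = mk⇔
      (λ x⊩□ψ (y , sy) (z , xRz , y⊑z) →
         Equivalence.to (ih y sy) (⊩-persistent ψ (x⊩□ψ z xRz) y⊑z))
      (λ x⊨□ψ z xRz → IsRO-from-dense ⊑-trans (⊩-IsRO ψ) Sφ-isDense z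
         (λ y sy y⊑z → Equivalence.from (ih y sy) (x⊨□ψ (y , sy) (z , xRz , y⊑z))))
      where
        ih = ⊩⇔⊨Mφ ψ (Sub-trans (inBox here) □ψ≤φ)

lemma5p3p22 : ExcludedMiddle 0ℓ →
    {I Var : Set} (M : PossModel I Var) (φ : Form I Var) →
    ((x : PossModel.S M) → Σ[ x' ∈ PossModel.S M ] (Sφ M φ x' × PossModel._⊑_ M x' x))
    × ((x : PossModel.S M) (sx : Sφ M φ x) (ψ : Form I Var) → Sub ψ φ →
    (_⊩_ M x ψ ⇔ _⊨_ (Mφ M φ) (x , sx) ψ))
lemma5p3p22 lem M φ =
  Sφ-dense M lem φ , λ x sx ψ ψ≤φ → ⊩⇔⊨Mφ M φ (Sφ-dense M lem φ) ψ ψ≤φ x sx
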